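{- Let $\mathcal{S}=(Q,\mathcal{B})$ be a nested SQS$(v)$ and let $\{F_1,\dots,F_{v-1}\}$ be a one-factorization of the complete graph $K_v$ on vertex set $Q$. Let $\mathcal{D}$ be the nested SQS$(2v)$ on $Q\times\{0,1\}$ whose blocks are: (Type I) $\{(x,i),(y,i),(z,i),(w,i)\}$ for $\{x,y,z,w\}\in\mathcal{B}$, $i\in\{0,1\}$, partitioned into $\{(x,i),(y,i)\}$ and $\{(z,i),(w,i)\}$ exactly when $\{x,y,z,w\}$ is partitioned into $\{x,y\}$ and $\{z,w\}$ in $\mathcal{S}$; and (Type II) $\{(x,0),(y,0),(z,1),(w,1)\}$ for $\{x,y\}\in F_i$, $\{z,w\}\in F_i$ (not necessarily distinct edges), $1\le i\le v-1$, partitioned into $\{(x,0),(y,0)\}$ and $\{(z,1),(w,1)\}$. Then for distinct $x,y\in Q$ and any integer $\mu\ge 0$, the multiplicity of $\{(x,0),(y,0)\}$ and of $\{(x,1),(y,1)\}$ in $\mathcal{D}$ is $\frac{v}{2}+\mu$ if and only if the pair $\{x,y\}$ has multiplicity $\mu$ in $\mathcal{S}$.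
   Context: A Steiner quadruple system SQS$(v)$ is a pair $(Q,\mathcal{B})$ where $Q$ is a set of $v$ points and $\mathcal{B}$ is a collection of 4-subsets of $Q$ (blocks) such that every 3-subset of $Q$ is contained in exactly one block. A nested SQS$(v)$ is an SQS$(v)$ together with a partition of each block into two 2-subsets (pairs). A pair of points is an ND-pair if it is one of the two pairs in the partition of at least one block; the multiplicity of a pair is the number of blocks whose partition contains that pair (zero if it is not an ND-pair). A one-factorization of $K_v$ ($v$ even) is a partition of its edge set into $v-1$ perfect matchings. (The block set described is a known doubling construction of an SQS$(2v)$.) -}

module Defs where

open import Data.Nat using (ℕ; zero; suc; _∸_; _<ᵇ_)
open import Data.Bool using (Bool; true; false; _∧_; _∨_; if_then_else_)
open import Data.Fin using (Fin; toℕ)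
open import Data.Fin.Properties using (_≟_)
open import Data.List using (List; []; _∷_; _++_; concatMap; filter; map)
open import Data.List.Relation.Unary.All using (All)
open import Data.Product using (_×_; _,_; Σ)
open import Data.Product.Properties using (≡-dec)
open import Data.Bool.Properties using () renaming (_≟_ to _≟B_)
open import Data.Fin using () renaming (_≟_ to _≟F_)
open import Relation.Nullary using (¬_; does)
open import Relation.Binary using (DecidableEquality)
open import Relation.Binary.PropositionalEquality using (_≡_; _≢_)
open import Data.List using (allFin)

-- A nested block: a 4-subset given together with its partition into two pairs,
-- written ((a , b) , (c , d)) meaning {a,b,c,d} split as {a,b} | {c,d}.
NestedBlock : Set → Set
NestedBlock A = (A × A) × (A × A)

module _ {A : Set} (_≟A_ : DecidableEquality A) where

  eqᵇ : A → A → Bool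
  eqᵇ a b = does (a ≟A b)

  samePairᵇ : A × A → A → A → Bool
  samePairᵇ (a , b) x y = (eqᵇ a x ∧ eqᵇ b y) ∨ (eqᵇ a y ∧ eqᵇ b x)

  hasPairᵇ : NestedBlock A → A → A → Bool
  hasPairᵇ (p , q) x y = samePairᵇ p x y ∨ samePairᵇ q x y

  countᵇ : {B : Set} → (B → Bool) → List B → ℕ
  countᵇ f [] = 0
  countᵇ f (b ∷ bs) = if f b then suc (countᵇ f bs) else countᵇ f bs

  multiplicity : List (NestedBlock A) → A → A → ℕ
  multiplicity 𝓑 x y = countᵇ (λ B → hasPairᵇ B x y) 𝓑

  memᵇ : A → NestedBlock A → Bool
  memᵇ x ((a , b) , (c , d)) = eqᵇ x a ∨ eqᵇ x b ∨ eqᵇ x c ∨ eqᵇ x d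

  WellFormed : NestedBlock A → Set
  WellFormed ((a , b) , (c , d)) =
    a ≢ b × a ≢ c × a ≢ d × b ≢ c × b ≢ d × c ≢ d

  IsNestedSQS : List (NestedBlock A) → Set
  IsNestedSQS 𝓑 =
    All WellFormed 𝓑 ×
    (∀ a b c → a ≢ b → a ≢ c → b ≢ c →
       countᵇ (λ B → memᵇ a B ∧ memᵇ b B ∧ memᵇ c B) 𝓑 ≡ 1)

-- One-factorization {F_1,...,F_{v-1}} of K_v on Fin v, given as the colouring
-- col x y = index of the one-factor containing the edge {x,y}
-- (col x x is irrelevant).
IsOneFactorization : (v : ℕ) → (Fin v → Fin v → Fin (v ∸ 1)) → Set
IsOneFactorization v col =
  (∀ x y → x ≢ y → col x y ≡ col y x) ×
  (∀ x i → Σ (Fin v) λ y → y ≢ x × col x y ≡ i ×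
             (∀ z → z ≢ x → col x z ≡ i → z ≡ y))

-- points of the doubled design: Q × {0,1}, with false = 0, true = 1
_≟P_ : {v : ℕ} → DecidableEquality (Fin v × Bool)
_≟P_ = ≡-dec _≟F_ _≟B_

factorEdges : (v : ℕ) → (Fin v → Fin v → Fin (v ∸ 1)) → Fin (v ∸ 1) → List (Fin v × Fin v)
factorEdges v col i =
  concatMap (λ x → concatMap (λ y →
     if (toℕ x <ᵇ toℕ y) ∧ does (col x y ≟F i) then (x , y) ∷ [] else [])
     (allFin v)) (allFin v)

typeI : {v : ℕ} → List (NestedBlock (Fin v)) → List (NestedBlock (Fin v × Bool))
typeI 𝓑 = concatMap (λ i → map (λ { ((x , y) , (z , w)) →
             (((x , i) , (y , i)) , ((z , i) , (w , i))) }) 𝓑) (false ∷ true ∷ [])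

typeII : (v : ℕ) → (Fin v → Fin v → Fin (v ∸ 1)) → List (NestedBlock (Fin v × Bool))
typeII v col = concatMap (λ i →
  concatMap (λ { (x , y) → map (λ { (z , w) →
      (((x , false) , (y , false)) , ((z , true) , (w , true))) })
    (factorEdges v col i) }) (factorEdges v col i)) (allFin (v ∸ 1))

doubled : (v : ℕ) → List (NestedBlock (Fin v)) → (Fin v → Fin v → Fin (v ∸ 1))
        → List (NestedBlock (Fin v × Bool))
doubled v 𝓑 col = typeI 𝓑 ++ typeII v col

-- A pair {x,y} on one level of the doubled design lies in the Type I blocks of
-- that level exactly as often as in 𝓢, and in the Type II blocks exactly
-- |F_i| = v/2 times, where F_i is the unique one-factor containing {x,y}: the
-- level-0 half of such a block must be {x,y} itself, while its level-1 half
-- ranges over all of F_i (and symmetrically for level 1). That each one-factor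
-- has v/2 edges is a double count: every point lies on exactly one edge of F_i.
module Submission where

open import Defs
open import Data.Nat using (ℕ; zero; suc; _+_; _*_; _∸_; _/_; _<_; _<ᵇ_)
open import Data.Nat.Properties
  using (+-identityʳ; +-comm; +-assoc; *-comm; *-identityˡ; *-identityʳ; *-zeroʳ; *-suc; *-distribʳ-+;
         +-cancelʳ-≡; <-cmp; <⇒≯; n≮n; <⇒<ᵇ; <ᵇ⇒<; +-*-semiring)
open import Data.Nat.DivMod using (m*n/n≡m)
open import Data.Bool using (Bool; true; false; _∧_; if_then_else_; T?)
open import Data.Bool.Properties
  using (∧-identityʳ; ∧-zeroʳ; ∨-identityʳ; ∨-comm; ∧-distribˡ-∨)
  renaming (_≟_ to _≟B_)
open import Data.Fin as Fin using (Fin; toℕ; punchIn)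
open import Data.Fin.Properties using (_≟_; toℕ-injective; punchInᵢ≢i)
open import Data.List using (List; []; _∷_; _++_; concatMap; map; length; tabulate)
open import Data.Product using (_×_; _,_; proj₁; proj₂)
open import Data.Product.Properties using (≡-dec)
open import Function using (_∘_)
open import Function.Bundles using (_⇔_; mk⇔)
open import Relation.Binary using (DecidableEquality; tri<; tri≈; tri>)
open import Relation.Binary.PropositionalEquality
  using (_≡_; _≢_; refl; sym; trans; cong; cong₂; _≗_; ≢-sym; module ≡-Reasoning)
open import Relation.Nullary using (does; yes; no; ¬_; contradiction)
open import Relation.Nullary.Decidable using (dec-true; dec-false)
open import Algebra.Properties.Semiring.Sum +-*-semiring
  using (sum; sum-syntax; sum-cong-≗; sum-remove; sum-replicate-zero;
         ∑-distrib-+; ∑-comm; *-distribʳ-sum)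

open ≡-Reasoning

𝟙 : Bool → ℕ
𝟙 true = 1
𝟙 false = 0

∧-tag : ∀ p q t → (p ∧ t) ∧ (q ∧ t) ≡ t ∧ (p ∧ q)
∧-tag p q true rewrite ∧-identityʳ p | ∧-identityʳ q = refl
∧-tag p q false rewrite ∧-zeroʳ p = refl

<ᵇ-true : ∀ {m n} → m < n → (m <ᵇ n) ≡ true
<ᵇ-true {m} {n} m<n = dec-true (T? (m <ᵇ n)) (<⇒<ᵇ m<n)

<ᵇ-false : ∀ {m n} → ¬ m < n → (m <ᵇ n) ≡ false
<ᵇ-false {m} {n} m≮n = dec-false (T? (m <ᵇ n)) (m≮n ∘ <ᵇ⇒< m n)

∑-ones : ∀ n → ∑[ a < n ] 1 ≡ n
∑-ones zero = refl
∑-ones (suc n) = cong suc (∑-ones n)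

∑-single : ∀ {n} (f : Fin n → ℕ) (a : Fin n) → (∀ b → b ≢ a → f b ≡ 0) → sum f ≡ f a
∑-single {suc n} f a vanishes = begin
  sum f                        ≡⟨ sum-remove {i = a} f ⟩
  f a + sum (f ∘ punchIn a)    ≡⟨ cong (f a +_) (sum-cong-≗ {n} (λ b → vanishes _ (punchInᵢ≢i a b))) ⟩
  f a + sum {n} (λ _ → 0)      ≡⟨ cong (f a +_) (sum-replicate-zero n) ⟩
  f a + 0                      ≡⟨ +-identityʳ (f a) ⟩
  f a                          ∎

∑-𝟙-≟-∧ : ∀ {n} (p : Fin n) (f : Fin n → Bool) → ∑[ a < n ] 𝟙 (does (a ≟ p) ∧ f a) ≡ 𝟙 (f p)
∑-𝟙-≟-∧ p f = trans (∑-single _ p vanishes) (cong (λ t → 𝟙 (t ∧ f p)) (dec-true (p ≟ p) refl))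
  where
  vanishes : ∀ a → a ≢ p → 𝟙 (does (a ≟ p) ∧ f a) ≡ 0
  vanishes a a≢p rewrite dec-false (a ≟ p) a≢p = refl

∑-𝟙-≟ : ∀ {n} (c : Fin n) → ∑[ i < n ] 𝟙 (does (c ≟ i)) ≡ 1
∑-𝟙-≟ c = trans (∑-single _ c vanishes) (cong 𝟙 (dec-true (c ≟ c) refl))
  where
  vanishes : ∀ i → i ≢ c → 𝟙 (does (c ≟ i)) ≡ 0
  vanishes i i≢c rewrite dec-false (c ≟ i) (≢-sym i≢c) = refl

countᵇ-≟-irrelevant : ∀ {A A′ B : Set} (d : DecidableEquality A) (d′ : DecidableEquality A′)
  (f : B → Bool) xs → countᵇ d f xs ≡ countᵇ d′ f xs
countᵇ-≟-irrelevant d d′ f [] = refl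
countᵇ-≟-irrelevant d d′ f (x ∷ xs) with f x
... | true = cong suc (countᵇ-≟-irrelevant d d′ f xs)
... | false = countᵇ-≟-irrelevant d d′ f xs

module _ {A : Set} (_≟A_ : DecidableEquality A) where

  countᵇ-∷ : ∀ {B} (f : B → Bool) b bs → countᵇ _≟A_ f (b ∷ bs) ≡ 𝟙 (f b) + countᵇ _≟A_ f bs
  countᵇ-∷ f b bs with f b
  ... | true = refl
  ... | false = refl

  countᵇ-++ : ∀ {B} (f : B → Bool) xs ys →
    countᵇ _≟A_ f (xs ++ ys) ≡ countᵇ _≟A_ f xs + countᵇ _≟A_ f ys
  countᵇ-++ f [] ys = refl
  countᵇ-++ f (x ∷ xs) ys = begin
    countᵇ _≟A_ f (x ∷ xs ++ ys)                         ≡⟨ countᵇ-∷ f x (xs ++ ys) ⟩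
    𝟙 (f x) + countᵇ _≟A_ f (xs ++ ys)                   ≡⟨ cong (𝟙 (f x) +_) (countᵇ-++ f xs ys) ⟩
    𝟙 (f x) + (countᵇ _≟A_ f xs + countᵇ _≟A_ f ys)      ≡⟨ sym (+-assoc (𝟙 (f x)) _ _) ⟩
    𝟙 (f x) + countᵇ _≟A_ f xs + countᵇ _≟A_ f ys        ≡⟨ cong (_+ countᵇ _≟A_ f ys) (sym (countᵇ-∷ f x xs)) ⟩
    countᵇ _≟A_ f (x ∷ xs) + countᵇ _≟A_ f ys            ∎

  countᵇ-map : ∀ {B C : Set} (f : C → Bool) (g : B → C) xs →
    countᵇ _≟A_ f (map g xs) ≡ countᵇ _≟A_ (f ∘ g) xs
  countᵇ-map f g [] = refl
  countᵇ-map f g (x ∷ xs) with f (g x)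
  ... | true = cong suc (countᵇ-map f g xs)
  ... | false = countᵇ-map f g xs

  countᵇ-cong : ∀ {B} {f g : B → Bool} → f ≗ g → ∀ xs → countᵇ _≟A_ f xs ≡ countᵇ _≟A_ g xs
  countᵇ-cong f≗g [] = refl
  countᵇ-cong {f = f} {g} f≗g (x ∷ xs) = begin
    countᵇ _≟A_ f (x ∷ xs)          ≡⟨ countᵇ-∷ f x xs ⟩
    𝟙 (f x) + countᵇ _≟A_ f xs      ≡⟨ cong₂ _+_ (cong 𝟙 (f≗g x)) (countᵇ-cong f≗g xs) ⟩
    𝟙 (g x) + countᵇ _≟A_ g xs      ≡⟨ sym (countᵇ-∷ g x xs) ⟩
    countᵇ _≟A_ g (x ∷ xs)          ∎

  countᵇ-const : ∀ {B} (c : Bool) (xs : List B) → countᵇ _≟A_ (λ _ → c) xs ≡ 𝟙 c * length xs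
  countᵇ-const c [] = sym (*-zeroʳ (𝟙 c))
  countᵇ-const c (x ∷ xs) = begin
    countᵇ _≟A_ (λ _ → c) (x ∷ xs)      ≡⟨ countᵇ-∷ (λ _ → c) x xs ⟩
    𝟙 c + countᵇ _≟A_ (λ _ → c) xs      ≡⟨ cong (𝟙 c +_) (countᵇ-const c xs) ⟩
    𝟙 c + 𝟙 c * length xs               ≡⟨ sym (*-suc (𝟙 c) (length xs)) ⟩
    𝟙 c * length (x ∷ xs)               ∎

  countᵇ-∧ˡ : ∀ {B} c (f : B → Bool) xs → countᵇ _≟A_ (λ b → c ∧ f b) xs ≡ 𝟙 c * countᵇ _≟A_ f xs
  countᵇ-∧ˡ true f xs = sym (+-identityʳ (countᵇ _≟A_ f xs))
  countᵇ-∧ˡ false f xs = countᵇ-const false xs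

  countᵇ-singleton? : ∀ {B} (f : B → Bool) c b →
    countᵇ _≟A_ f (if c then b ∷ [] else []) ≡ 𝟙 (c ∧ f b)
  countᵇ-singleton? f true b = trans (countᵇ-∷ f b []) (+-identityʳ (𝟙 (f b)))
  countᵇ-singleton? f false b = refl

  countᵇ-concatMap-tabulate : ∀ {B C : Set} n (f : C → Bool) (g : B → List C) (h : Fin n → B) →
    countᵇ _≟A_ f (concatMap g (tabulate h)) ≡ ∑[ i < n ] countᵇ _≟A_ f (g (h i))
  countᵇ-concatMap-tabulate zero f g h = refl
  countᵇ-concatMap-tabulate (suc n) f g h =
    trans (countᵇ-++ f (g (h Fin.zero)) _)
          (cong (countᵇ _≟A_ f (g (h Fin.zero)) +_) (countᵇ-concatMap-tabulate n f g (h ∘ Fin.suc)))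

  countᵇ-product-fst : ∀ {B B′ C : Set} (f : C → Bool) (g : B → B′ → C) (s : B → Bool) →
    (∀ e e′ → f (g e e′) ≡ s e) → ∀ xs ys →
    countᵇ _≟A_ f (concatMap (λ e → map (g e) ys) xs) ≡ countᵇ _≟A_ s xs * length ys
  countᵇ-product-fst f g s f∘g≡s [] ys = refl
  countᵇ-product-fst f g s f∘g≡s (x ∷ xs) ys = begin
    countᵇ _≟A_ f (map (g x) ys ++ concatMap (λ e → map (g e) ys) xs)
      ≡⟨ countᵇ-++ f (map (g x) ys) _ ⟩
    countᵇ _≟A_ f (map (g x) ys) + countᵇ _≟A_ f (concatMap (λ e → map (g e) ys) xs)
      ≡⟨ cong₂ _+_ (trans (countᵇ-map f (g x) ys) (countᵇ-cong (f∘g≡s x) ys))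
                   (countᵇ-product-fst f g s f∘g≡s xs ys) ⟩
    countᵇ _≟A_ (λ _ → s x) ys + countᵇ _≟A_ s xs * length ys
      ≡⟨ cong (_+ countᵇ _≟A_ s xs * length ys) (countᵇ-const (s x) ys) ⟩
    𝟙 (s x) * length ys + countᵇ _≟A_ s xs * length ys
      ≡⟨ sym (*-distribʳ-+ (length ys) (𝟙 (s x)) _) ⟩
    (𝟙 (s x) + countᵇ _≟A_ s xs) * length ys
      ≡⟨ cong (_* length ys) (sym (countᵇ-∷ s x xs)) ⟩
    countᵇ _≟A_ s (x ∷ xs) * length ys ∎

  countᵇ-product-snd : ∀ {B B′ C : Set} (f : C → Bool) (g : B → B′ → C) (s : B′ → Bool) →
    (∀ e e′ → f (g e e′) ≡ s e′) → ∀ xs ys →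
    countᵇ _≟A_ f (concatMap (λ e → map (g e) ys) xs) ≡ length xs * countᵇ _≟A_ s ys
  countᵇ-product-snd f g s f∘g≡s [] ys = refl
  countᵇ-product-snd f g s f∘g≡s (x ∷ xs) ys =
    trans (countᵇ-++ f (map (g x) ys) _)
          (cong₂ _+_ (trans (countᵇ-map f (g x) ys) (countᵇ-cong {f = f ∘ g x} (f∘g≡s x) ys))
                     (countᵇ-product-snd f g s f∘g≡s xs ys))

layer : {A : Set} → Bool → NestedBlock A → NestedBlock (A × Bool)
layer i ((a , b) , (c , d)) = ((a , i) , (b , i)) , ((c , i) , (d , i))

stack : {A : Set} → A × A → A × A → NestedBlock (A × Bool)
stack (a , b) (c , d) = ((a , false) , (b , false)) , ((c , true) , (d , true))

module _ {A : Set} (_≟A_ : DecidableEquality A) where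

  private
    _≟×_ : DecidableEquality (A × Bool)
    _≟×_ = ≡-dec _≟A_ _≟B_

  eqᵇ-, : ∀ a b i j → eqᵇ _≟×_ (a , i) (b , j) ≡ eqᵇ _≟A_ a b ∧ eqᵇ _≟B_ i j
  eqᵇ-, a b i j with a ≟A b
  ... | yes refl = refl
  ... | no _ = refl

  samePairᵇ-tagged : ∀ a b i x y j →
    samePairᵇ _≟×_ ((a , i) , (b , i)) (x , j) (y , j) ≡ eqᵇ _≟B_ i j ∧ samePairᵇ _≟A_ (a , b) x y
  samePairᵇ-tagged a b i x y j
    rewrite eqᵇ-, a x i j | eqᵇ-, b y i j | eqᵇ-, a y i j | eqᵇ-, b x i j
          | ∧-tag (eqᵇ _≟A_ a x) (eqᵇ _≟A_ b y) (eqᵇ _≟B_ i j)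
          | ∧-tag (eqᵇ _≟A_ a y) (eqᵇ _≟A_ b x) (eqᵇ _≟B_ i j)
    = sym (∧-distribˡ-∨ (eqᵇ _≟B_ i j) _ _)

  samePairᵇ-sym : ∀ e x y → samePairᵇ _≟A_ e x y ≡ samePairᵇ _≟A_ e y x
  samePairᵇ-sym (a , b) x y = ∨-comm (eqᵇ _≟A_ a x ∧ eqᵇ _≟A_ b y) _

  hasPairᵇ-layer : ∀ i B x y j →
    hasPairᵇ _≟×_ (layer i B) (x , j) (y , j) ≡ eqᵇ _≟B_ i j ∧ hasPairᵇ _≟A_ B x y
  hasPairᵇ-layer i ((a , b) , (c , d)) x y j
    rewrite samePairᵇ-tagged a b i x y j | samePairᵇ-tagged c d i x y j
    = sym (∧-distribˡ-∨ (eqᵇ _≟B_ i j) _ _)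

  hasPairᵇ-stack-bottom : ∀ e e′ x y →
    hasPairᵇ _≟×_ (stack e e′) (x , false) (y , false) ≡ samePairᵇ _≟A_ e x y
  hasPairᵇ-stack-bottom (a , b) (c , d) x y
    rewrite samePairᵇ-tagged a b false x y false | samePairᵇ-tagged c d true x y false
    = ∨-identityʳ _

  hasPairᵇ-stack-top : ∀ e e′ x y →
    hasPairᵇ _≟×_ (stack e e′) (x , true) (y , true) ≡ samePairᵇ _≟A_ e′ x y
  hasPairᵇ-stack-top (a , b) (c , d) x y
    rewrite samePairᵇ-tagged a b false x y true | samePairᵇ-tagged c d true x y true
    = refl

module _ {v : ℕ} (col : Fin v → Fin v → Fin (v ∸ 1)) where

  isEdge : Fin (v ∸ 1) → Fin v → Fin v → Bool
  isEdge i a b = (toℕ a <ᵇ toℕ b) ∧ does (col a b ≟ i)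

  countᵇ-factorEdges : ∀ i (h : Fin v × Fin v → Bool) →
    countᵇ (_≟_ {v}) h (factorEdges v col i) ≡ ∑[ a < v ] ∑[ b < v ] 𝟙 (isEdge i a b ∧ h (a , b))
  countᵇ-factorEdges i h =
    trans (countᵇ-concatMap-tabulate (_≟_ {v}) v h _ (λ a → a))
          (sum-cong-≗ (λ a →
             trans (countᵇ-concatMap-tabulate (_≟_ {v}) v h _ (λ b → b))
                   (sum-cong-≗ (λ b → countᵇ-singleton? (_≟_ {v}) h (isEdge i a b) (a , b)))))

  isEdge-irrefl : ∀ i a → isEdge i a a ≡ false
  isEdge-irrefl i a rewrite <ᵇ-false (n≮n (toℕ a)) = refl

  isEdge∧reversed : ∀ i {p q} → toℕ p < toℕ q → ∀ a b →
    isEdge i a b ∧ (does (a ≟ q) ∧ does (b ≟ p)) ≡ false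
  isEdge∧reversed i {p} {q} p<q a b with a ≟ q | b ≟ p
  ... | yes refl | yes refl rewrite <ᵇ-false (<⇒≯ p<q) = refl
  ... | yes _    | no _     = ∧-zeroʳ (isEdge i a b)
  ... | no _     | _        = ∧-zeroʳ (isEdge i a b)

  isEdge∧samePairᵇ : ∀ i {p q} → toℕ p < toℕ q → ∀ a b →
    isEdge i a b ∧ samePairᵇ _≟_ (a , b) p q ≡ does (a ≟ p) ∧ (does (b ≟ q) ∧ does (col p q ≟ i))
  isEdge∧samePairᵇ i {p} {q} p<q a b with a ≟ p | b ≟ q
  ... | yes refl | yes refl rewrite <ᵇ-true p<q = ∧-identityʳ (does (col a b ≟ i))
  ... | yes refl | no _
    rewrite dec-false (a ≟ q) (λ { refl → n≮n _ p<q }) = ∧-zeroʳ (isEdge i a b)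
  ... | no _     | _ = isEdge∧reversed i p<q a b

  countᵇ-samePairᵇ-ordered : ∀ i {p q} → toℕ p < toℕ q →
    countᵇ (_≟_ {v}) (λ e → samePairᵇ _≟_ e p q) (factorEdges v col i) ≡ 𝟙 (does (col p q ≟ i))
  countᵇ-samePairᵇ-ordered i {p} {q} p<q = begin
    countᵇ (_≟_ {v}) (λ e → samePairᵇ _≟_ e p q) (factorEdges v col i)
      ≡⟨ countᵇ-factorEdges i _ ⟩
    ∑[ a < v ] ∑[ b < v ] 𝟙 (isEdge i a b ∧ samePairᵇ _≟_ (a , b) p q)
      ≡⟨ sum-cong-≗ (λ a → sum-cong-≗ (λ b → cong 𝟙 (isEdge∧samePairᵇ i p<q a b))) ⟩
    ∑[ a < v ] ∑[ b < v ] 𝟙 (does (a ≟ p) ∧ (does (b ≟ q) ∧ d))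
      ≡⟨ ∑-comm (λ a b → 𝟙 (does (a ≟ p) ∧ (does (b ≟ q) ∧ d))) ⟩
    ∑[ b < v ] ∑[ a < v ] 𝟙 (does (a ≟ p) ∧ (does (b ≟ q) ∧ d))
      ≡⟨ sum-cong-≗ (λ b → ∑-𝟙-≟-∧ p (λ _ → does (b ≟ q) ∧ d)) ⟩
    ∑[ b < v ] 𝟙 (does (b ≟ q) ∧ d)
      ≡⟨ ∑-𝟙-≟-∧ q (λ _ → d) ⟩
    𝟙 d ∎
    where d = does (col p q ≟ i)

  ∑-countᵇ-samePairᵇ : ∀ {p q} → p ≢ q →
    ∑[ i < v ∸ 1 ] countᵇ (_≟_ {v}) (λ e → samePairᵇ _≟_ e p q) (factorEdges v col i) ≡ 1
  ∑-countᵇ-samePairᵇ {p} {q} p≢q with <-cmp (toℕ p) (toℕ q)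
  ... | tri< p<q _ _ =
    trans (sum-cong-≗ (λ i → countᵇ-samePairᵇ-ordered i p<q)) (∑-𝟙-≟ (col p q))
  ... | tri≈ _ p≡q _ = contradiction (toℕ-injective p≡q) p≢q
  ... | tri> _ _ q<p =
    trans (sum-cong-≗ (λ i → trans (countᵇ-cong (_≟_ {v}) (λ e → samePairᵇ-sym _≟_ e p q)
                                                (factorEdges v col i))
                                   (countᵇ-samePairᵇ-ordered i q<p)))
          (∑-𝟙-≟ (col q p))

  module _ (fac : IsOneFactorization v col) where

    𝟙-isEdge-either : ∀ i {a b} → a ≢ b →
      𝟙 (isEdge i a b) + 𝟙 (isEdge i b a) ≡ 𝟙 (does (col a b ≟ i))
    𝟙-isEdge-either i {a} {b} a≢b with <-cmp (toℕ a) (toℕ b)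
    ... | tri< a<b _ _ rewrite <ᵇ-true a<b | <ᵇ-false (<⇒≯ a<b) = +-identityʳ _
    ... | tri≈ _ a≡b _ = contradiction (toℕ-injective a≡b) a≢b
    ... | tri> _ _ b<a
      rewrite <ᵇ-false (<⇒≯ b<a) | <ᵇ-true b<a | proj₁ fac b a (≢-sym a≢b) = refl

    edges-at-point : ∀ i a → ∑[ b < v ] (𝟙 (isEdge i a b) + 𝟙 (isEdge i b a)) ≡ 1
    edges-at-point i a with proj₂ fac a i
    ... | y , y≢a , col-a-y≡i , unique =
      trans (∑-single _ y vanishes)
            (trans (𝟙-isEdge-either i (≢-sym y≢a)) (cong 𝟙 (dec-true (col a y ≟ i) col-a-y≡i)))
      where
      vanishes : ∀ b → b ≢ y → 𝟙 (isEdge i a b) + 𝟙 (isEdge i b a) ≡ 0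
      vanishes b b≢y with b ≟ a
      ... | yes refl rewrite isEdge-irrefl i b = refl
      ... | no b≢a = trans (𝟙-isEdge-either i (≢-sym b≢a))
                           (cong 𝟙 (dec-false (col a b ≟ i) (b≢y ∘ unique b b≢a)))

    length-factorEdges : ∀ i → length (factorEdges v col i) ≡ v / 2
    length-factorEdges i = begin
      length F         ≡⟨ length≡edges ⟩
      edges            ≡⟨ sym (m*n/n≡m edges 2) ⟩
      edges * 2 / 2    ≡⟨ cong (_/ 2) (trans (*-suc edges 1) (cong (edges +_) (*-identityʳ edges))) ⟩
      (edges + edges) / 2 ≡⟨ cong (_/ 2) edges+edges≡v ⟩
      v / 2            ∎
      where
      F = factorEdges v col i
      e : Fin v → Fin v → ℕ
      e a b = 𝟙 (isEdge i a b)
      edges = ∑[ a < v ] ∑[ b < v ] e a b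

      length≡edges : length F ≡ edges
      length≡edges = begin
        length F                                   ≡⟨ sym (*-identityˡ (length F)) ⟩
        𝟙 true * length F                          ≡⟨ sym (countᵇ-const (_≟_ {v}) true F) ⟩
        countᵇ (_≟_ {v}) (λ _ → true) F            ≡⟨ countᵇ-factorEdges i _ ⟩
        ∑[ a < v ] ∑[ b < v ] 𝟙 (isEdge i a b ∧ true)
          ≡⟨ sum-cong-≗ (λ a → sum-cong-≗ (λ b → cong 𝟙 (∧-identityʳ (isEdge i a b)))) ⟩
        edges                                      ∎

      edges+edges≡v : edges + edges ≡ v
      edges+edges≡v = begin
        edges + edges
          ≡⟨ cong (edges +_) (sym (∑-comm (λ a b → e b a))) ⟩
        edges + ∑[ a < v ] ∑[ b < v ] e b a
          ≡⟨ sym (∑-distrib-+ (λ a → ∑[ b < v ] e a b) _) ⟩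
        ∑[ a < v ] (∑[ b < v ] e a b + ∑[ b < v ] e b a)
          ≡⟨ sum-cong-≗ (λ a → sym (∑-distrib-+ (e a) (λ b → e b a))) ⟩
        ∑[ a < v ] ∑[ b < v ] (e a b + e b a)
          ≡⟨ sum-cong-≗ (edges-at-point i) ⟩
        ∑[ a < v ] 1
          ≡⟨ ∑-ones v ⟩
        v ∎

module _ {v : ℕ} (x y : Fin v) where

  private
    atLevel : Bool → NestedBlock (Fin v × Bool) → Bool
    atLevel j B = hasPairᵇ _≟P_ B (x , j) (y , j)

    isPair : Fin v × Fin v → Bool
    isPair e = samePairᵇ _≟_ e x y

  countᵇ-layer : ∀ i j (𝓑 : List (NestedBlock (Fin v))) →
    countᵇ (_≟P_ {v}) (atLevel j) (map (layer i) 𝓑) ≡ 𝟙 (eqᵇ _≟B_ i j) * multiplicity _≟_ 𝓑 x y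
  countᵇ-layer i j 𝓑 = begin
    countᵇ (_≟P_ {v}) (atLevel j) (map (layer i) 𝓑)
      ≡⟨ countᵇ-map (_≟P_ {v}) (atLevel j) (layer i) 𝓑 ⟩
    countᵇ (_≟P_ {v}) (atLevel j ∘ layer i) 𝓑
      ≡⟨ countᵇ-cong (_≟P_ {v}) (λ B → hasPairᵇ-layer _≟_ i B x y j) 𝓑 ⟩
    countᵇ (_≟P_ {v}) (λ B → eqᵇ _≟B_ i j ∧ hasPairᵇ _≟_ B x y) 𝓑
      ≡⟨ countᵇ-∧ˡ (_≟P_ {v}) (eqᵇ _≟B_ i j) _ 𝓑 ⟩
    𝟙 (eqᵇ _≟B_ i j) * countᵇ (_≟P_ {v}) (λ B → hasPairᵇ _≟_ B x y) 𝓑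
      ≡⟨ cong (𝟙 (eqᵇ _≟B_ i j) *_) (countᵇ-≟-irrelevant (_≟P_ {v}) (_≟_ {v}) _ 𝓑) ⟩
    𝟙 (eqᵇ _≟B_ i j) * multiplicity _≟_ 𝓑 x y ∎

  countᵇ-typeI : ∀ j (𝓑 : List (NestedBlock (Fin v))) →
    countᵇ (_≟P_ {v}) (atLevel j) (typeI 𝓑) ≡ multiplicity _≟_ 𝓑 x y
  countᵇ-typeI j 𝓑 = begin
    countᵇ (_≟P_ {v}) (atLevel j) (map (layer false) 𝓑 ++ map (layer true) 𝓑 ++ [])
      ≡⟨ countᵇ-++ (_≟P_ {v}) (atLevel j) (map (layer false) 𝓑) _ ⟩
    countᵇ (_≟P_ {v}) (atLevel j) (map (layer false) 𝓑)
      + countᵇ (_≟P_ {v}) (atLevel j) (map (layer true) 𝓑 ++ [])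
      ≡⟨ cong₂ _+_ (countᵇ-layer false j 𝓑)
                   (trans (countᵇ-++ (_≟P_ {v}) (atLevel j) (map (layer true) 𝓑) [])
                          (cong (_+ 0) (countᵇ-layer true j 𝓑))) ⟩
    𝟙 (eqᵇ _≟B_ false j) * m + (𝟙 (eqᵇ _≟B_ true j) * m + 0)
      ≡⟨ one-level j ⟩
    m ∎
    where
    m = multiplicity _≟_ 𝓑 x y
    one-level : ∀ j → 𝟙 (eqᵇ _≟B_ false j) * m + (𝟙 (eqᵇ _≟B_ true j) * m + 0) ≡ m
    one-level false = trans (+-identityʳ (m + 0)) (+-identityʳ m)
    one-level true = trans (+-identityʳ (m + 0)) (+-identityʳ m)

  countᵇ-stacks : ∀ j (L : List (Fin v × Fin v)) →
    countᵇ (_≟P_ {v}) (atLevel j) (concatMap (λ e → map (stack e) L) L)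
      ≡ countᵇ (_≟_ {v}) isPair L * length L
  countᵇ-stacks false L =
    trans (countᵇ-product-fst (_≟P_ {v}) (atLevel false) stack isPair
             (λ e e′ → hasPairᵇ-stack-bottom _≟_ e e′ x y) L L)
          (cong (_* length L) (countᵇ-≟-irrelevant (_≟P_ {v}) (_≟_ {v}) isPair L))
  countᵇ-stacks true L =
    trans (countᵇ-product-snd (_≟P_ {v}) (atLevel true) stack isPair
             (λ e e′ → hasPairᵇ-stack-top _≟_ e e′ x y) L L)
          (trans (*-comm (length L) _)
                 (cong (_* length L) (countᵇ-≟-irrelevant (_≟P_ {v}) (_≟_ {v}) isPair L)))

  countᵇ-typeII : ∀ col → IsOneFactorization v col → x ≢ y → ∀ j →
    countᵇ (_≟P_ {v}) (atLevel j) (typeII v col) ≡ v / 2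
  countᵇ-typeII col fac x≢y j = begin
    countᵇ (_≟P_ {v}) (atLevel j) (typeII v col)
      ≡⟨ countᵇ-concatMap-tabulate (_≟P_ {v}) (v ∸ 1) (atLevel j) _ (λ i → i) ⟩
    ∑[ i < v ∸ 1 ] countᵇ (_≟P_ {v}) (atLevel j) (concatMap (λ e → map (stack e) (F i)) (F i))
      ≡⟨ sum-cong-≗ (λ i → countᵇ-stacks j (F i)) ⟩
    ∑[ i < v ∸ 1 ] (countᵇ (_≟_ {v}) isPair (F i) * length (F i))
      ≡⟨ sum-cong-≗ (λ i → cong (countᵇ (_≟_ {v}) isPair (F i) *_) (length-factorEdges col fac i)) ⟩
    ∑[ i < v ∸ 1 ] (countᵇ (_≟_ {v}) isPair (F i) * (v / 2))
      ≡⟨ sym (*-distribʳ-sum (v / 2) (λ i → countᵇ (_≟_ {v}) isPair (F i))) ⟩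
    (∑[ i < v ∸ 1 ] countᵇ (_≟_ {v}) isPair (F i)) * (v / 2)
      ≡⟨ cong (_* (v / 2)) (∑-countᵇ-samePairᵇ col x≢y) ⟩
    1 * (v / 2)
      ≡⟨ *-identityˡ (v / 2) ⟩
    v / 2 ∎
    where F = factorEdges v col

multiplicity-doubled : ∀ {v} (𝓑 : List (NestedBlock (Fin v))) col → IsOneFactorization v col →
  ∀ {x y} → x ≢ y → ∀ j →
  multiplicity _≟P_ (doubled v 𝓑 col) (x , j) (y , j) ≡ multiplicity _≟_ 𝓑 x y + v / 2
multiplicity-doubled {v} 𝓑 col fac {x} {y} x≢y j =
  trans (countᵇ-++ (_≟P_ {v}) _ (typeI 𝓑) (typeII v col))
        (cong₂ _+_ (countᵇ-typeI x y j 𝓑) (countᵇ-typeII x y col fac x≢y j))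

+-shift-⇔ : ∀ {d m k μ : ℕ} → d ≡ m + k → (d ≡ k + μ) ⇔ (m ≡ μ)
+-shift-⇔ {d} {m} {k} {μ} d≡m+k = mk⇔
  (λ d≡k+μ → +-cancelʳ-≡ k m μ (trans (sym d≡m+k) (trans d≡k+μ (+-comm k μ))))
  (λ { refl → trans d≡m+k (+-comm m k) })

lemma3p4 : (v : ℕ) (𝓑 : List (NestedBlock (Fin v))) → IsNestedSQS _≟_ 𝓑 →
    (col : Fin v → Fin v → Fin (v ∸ 1)) → IsOneFactorization v col →
    (x y : Fin v) → x ≢ y → (μ : ℕ) →
    ((multiplicity _≟P_ (doubled v 𝓑 col) (x , false) (y , false) ≡ v / 2 + μ)
       ⇔ (multiplicity _≟_ 𝓑 x y ≡ μ))
    × ((multiplicity _≟P_ (doubled v 𝓑 col) (x , true) (y , true) ≡ v / 2 + μ)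
       ⇔ (multiplicity _≟_ 𝓑 x y ≡ μ))
lemma3p4 v 𝓑 _ col fac x y x≢y μ =
  +-shift-⇔ (multiplicity-doubled 𝓑 col fac x≢y false) ,
  +-shift-⇔ (multiplicity-doubled 𝓑 col fac x≢y true)
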